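{- Let $s$ and $t$ be integers of opposite parity. For every integer $n\ge0$, $$\nu_2(C_{\{n\}})=\begin{cases}\zeta_2(n+1)-1 & \text{if $t$ is odd},\\ 0 & \text{if $t$ is even}.\end{cases}$$
   Context: For indeterminates $s,t$: $\{0\}=0$, $\{1\}=1$, $\{n\}=s\{n-1\}+t\{n-2\}$ ($n\ge2$); $\{n\}!=\{1\}\cdots\{n\}$; $\left\{ n\atop k\right\}=\frac{\{n\}!}{\{k\}!\{n-k\}!}$. The generalized Catalan number is $C_{\{n\}}=\frac{1}{\{n+1\}}\left\{ {2n}\atop n\right\}$, which is a polynomial in $s,t$ with nonnegative integer coefficients; for integer $s,t$ it denotes the value of this polynomial. $\nu_2$ is the $2$-adic valuation ($\nu_2(0)=\infty$), and $\zeta_2(m)$ is the number of nonzero digits in the binary expansion of $m$. -}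

module Defs where

open import Data.Nat as ℕ using (ℕ; zero; suc; _∸_)
open import Data.Nat.DivMod using (_/_; _%_)
open import Data.Integer as ℤ using (ℤ; _+_; _*_; +_; -_)
open import Data.Integer.Divisibility using (_∣_)
open import Data.Product using (_×_)
open import Relation.Binary.PropositionalEquality using (_≡_; _≢_)
open import Relation.Nullary using (¬_)

luc : ℤ → ℤ → ℕ → ℤ
luc s t zero = + 0
luc s t (suc zero) = + 1
luc s t (suc (suc n)) = s * luc s t (suc n) + t * luc s t n

lfact : ℤ → ℤ → ℕ → ℤ
lfact s t zero = + 1
lfact s t (suc n) = lfact s t n * luc s t (suc n)

data Poly : Set where
  con  : ℤ → Poly
  varS : Poly
  varT : Poly
  _⊕_  : Poly → Poly → Poly
  _⊗_  : Poly → Poly → Poly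

eval : Poly → ℤ → ℤ → ℤ
eval (con c) a b = c
eval varS a b = a
eval varT a b = b
eval (p ⊕ q) a b = eval p a b + eval q a b
eval (p ⊗ q) a b = eval p a b * eval q a b

-- P represents the generalized Catalan polynomial C_{n}, i.e.
-- P = {2n}! / ({n+1} {n}! {n}!) as polynomials, i.e. the polynomial identity
-- P · {n+1}·{n}!·{n}! = {2n}!  holds (equivalently, holds at all integer points).
IsCatalanPoly : ℕ → Poly → Set
IsCatalanPoly n P = ∀ a b →
  eval P a b * (luc a b (suc n) * (lfact a b n * lfact a b n)) ≡ lfact a b (2 ℕ.* n)

ν₂≡ : ℤ → ℕ → Set
ν₂≡ x k = (x ≢ + 0) × ((+ (2 ℕ.^ k)) ∣ x) × ¬ ((+ (2 ℕ.^ suc k)) ∣ x)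

popcountF : ℕ → ℕ → ℕ
popcountF zero m = 0
popcountF (suc f) m = (m % 2) ℕ.+ popcountF f (m / 2)

ζ₂ : ℕ → ℕ
ζ₂ m = popcountF m m

Odd : ℤ → Set
Odd x = ¬ ((+ 2) ∣ x)

Even : ℤ → Set
Even x = (+ 2) ∣ x

-- If t is even then s is odd, every {m} is odd, and hence so is C_{n}.
-- If t is odd then s is even, and for s ≠ 0 the doubling formula {2m} = {m}(2{m+1} − s{m})
-- gives ν₂{m} = 0 for odd m and ν₂{m} = ν₂(m) + ν₂(s) − 1 for even m. Both {2n}! and
-- {n+1}{n}!² have exactly n factors of even index, so the ν₂(s) − 1 contributions cancel and
-- ν₂(C_{n}) is ν₂ of the ordinary Catalan number, ζ₂(n+1) − 1 by Legendre's formula.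
-- For s = 0 the defining identity is uninformative, but C_{n}(0,t) ≡ C_{n}(2^(κ+1),t)
-- modulo 2^(κ+1) for κ = ζ₂(n+1) − 1, which settles that case as well.
module Submission where

open import Defs
open import Data.Nat as ℕ using (ℕ; zero; suc; _∸_)
import Data.Nat.Properties as ℕP
open import Data.Nat.DivMod as ℕ÷ using ()
open import Data.Nat.Induction using (<-rec)
import Data.Nat.Divisibility as ℕ∣
open import Data.Nat.Tactic.RingSolver as ℕRing using ()
open import Data.Integer as ℤ using (ℤ; +_; -[1+_]; -_; _+_; _-_; _*_)
import Data.Integer.Properties as ℤP
import Data.Integer.DivMod as ℤ÷
open import Data.Integer.Divisibility.Signed
  using (_∣_; divides; ∣-refl; ∣-trans; ∣ᵤ⇒∣; ∣⇒∣ᵤ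
        ; ∣m⇒∣-m; ∣m+n∣m⇒∣n; ∣m∣n⇒∣m+n; ∣n⇒∣m*n; ∣m⇒∣m*n)
open import Data.Integer.Tactic.RingSolver using (solve-∀)
open import Data.List using (_∷_; [])
open import Data.Product using (∃-syntax; _×_; _,_)
open import Data.Sum using (_⊎_; inj₁; inj₂)
open import Data.Empty using (⊥-elim)
open import Relation.Nullary using (¬_; yes; no)
open import Relation.Binary.PropositionalEquality

private
  variable
    a b e k m : ℕ
    x y : ℤ

IsOdd : ℤ → Set
IsOdd x = ∃[ q ] x ≡ + 1 + + 2 * q

odd⇒¬even : IsOdd x → ¬ (+ 2 ∣ x)
odd⇒¬even (q , refl) 2∣x = 2≢1 (ℕ∣.∣1⇒≡1 (∣⇒∣ᵤ 2∣1))
  where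
  2∣1 : + 2 ∣ + 1
  2∣1 = ∣m+n∣m⇒∣n (subst (+ 2 ∣_) (ℤP.+-comm (+ 1) (+ 2 * q)) 2∣x) (divides q (ℤP.*-comm (+ 2) q))
  2≢1 : 2 ≢ 1
  2≢1 ()

odd⊎even : ∀ x → IsOdd x ⊎ + 2 ∣ x
odd⊎even x with x ℤ÷.% + 2 | ℤ÷.a≡a%n+[a/n]*n x (+ 2) | ℤ÷.n%d<d x (+ 2)
... | 0 | eq | _ = inj₂ (divides (x ℤ÷./ + 2) (trans eq (ℤP.+-identityˡ _)))
... | 1 | eq | _ = inj₁ (x ℤ÷./ + 2 , trans eq (cong (λ z → + 1 + z) (ℤP.*-comm (x ℤ÷./ + 2) (+ 2))))
... | suc (suc _) | _ | ℕ.s≤s (ℕ.s≤s ())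

Odd⇒IsOdd : Odd x → IsOdd x
Odd⇒IsOdd {x} ¬2∣x with odd⊎even x
... | inj₁ x-odd = x-odd
... | inj₂ 2∣x = ⊥-elim (¬2∣x (∣⇒∣ᵤ 2∣x))

odd-* : IsOdd x → IsOdd y → IsOdd (x * y)
odd-* (q , refl) (r , refl) = q + r + + 2 * q * r , lemma q r
  where
  lemma : ∀ q r → (+ 1 + + 2 * q) * (+ 1 + + 2 * r) ≡ + 1 + + 2 * (q + r + + 2 * q * r)
  lemma = solve-∀

odd-+-even : IsOdd x → + 2 ∣ y → IsOdd (x + y)
odd-+-even (q , refl) (divides r refl) = q + r , lemma q r
  where
  lemma : ∀ q r → + 1 + + 2 * q + r * + 2 ≡ + 1 + + 2 * (q + r)
  lemma = solve-∀

odd-neg : IsOdd x → IsOdd (- x)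
odd-neg (q , refl) = - + 1 - q , lemma q
  where
  lemma : ∀ q → - (+ 1 + + 2 * q) ≡ + 1 + + 2 * (- + 1 - q)
  lemma = solve-∀

odd-odd⇒even-sub : IsOdd x → IsOdd y → + 2 ∣ x - y
odd-odd⇒even-sub (q , refl) (r , refl) = divides (q - r) (lemma q r)
  where
  lemma : ∀ q r → + 1 + + 2 * q - (+ 1 + + 2 * r) ≡ (q - r) * + 2
  lemma = solve-∀

*-pres-∣ : ∀ {a b} → a ∣ x → b ∣ y → a * b ∣ x * y
*-pres-∣ {a = a} {b} (divides p refl) (divides q refl) = divides (p * q) (lemma p a q b)
  where
  lemma : ∀ p a q b → p * a * (q * b) ≡ p * q * (a * b)
  lemma = solve-∀

record Val₂ (k : ℕ) (x : ℤ) : Set where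
  constructor val₂
  field
    unit          : ℤ
    unit-odd      : IsOdd unit
    factorisation : x ≡ + (2 ℕ.^ k) * unit

pow₂-suc : ∀ k → + (2 ℕ.^ suc k) ≡ + 2 * + (2 ℕ.^ k)
pow₂-suc k = ℤP.pos-* 2 (2 ℕ.^ k)

pow₂-+ : ∀ a b → + (2 ℕ.^ (a ℕ.+ b)) ≡ + (2 ℕ.^ a) * + (2 ℕ.^ b)
pow₂-+ a b = trans (cong +_ (ℕP.^-distribˡ-+-* 2 a b)) (ℤP.pos-* (2 ℕ.^ a) (2 ℕ.^ b))

odd⇒Val₂0 : IsOdd x → Val₂ 0 x
odd⇒Val₂0 {x} x-odd = val₂ x x-odd (sym (ℤP.*-identityˡ x))

Val₂0⇒odd : Val₂ 0 x → IsOdd x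
Val₂0⇒odd (val₂ u u-odd refl) = subst IsOdd (sym (ℤP.*-identityˡ u)) u-odd

Val₂⇒∣ : Val₂ k x → + (2 ℕ.^ k) ∣ x
Val₂⇒∣ {k} (val₂ u _ refl) = divides u (ℤP.*-comm (+ (2 ℕ.^ k)) u)

Val₂-double : Val₂ k x → Val₂ (suc k) (+ 2 * x)
Val₂-double {k} (val₂ u u-odd refl) =
  val₂ u u-odd (trans (sym (ℤP.*-assoc (+ 2) (+ (2 ℕ.^ k)) u)) (cong (_* u) (sym (pow₂-suc k))))

Val₂-suc⇒even : Val₂ (suc k) x → + 2 ∣ x
Val₂-suc⇒even {k} (val₂ u _ refl) =
  divides (+ (2 ℕ.^ k) * u) (trans (cong (_* u) (pow₂-suc k)) (lemma (+ (2 ℕ.^ k)) u))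
  where
  lemma : ∀ p u → + 2 * p * u ≡ p * u * + 2
  lemma = solve-∀

Val₂-halve : Val₂ (suc k) (+ 2 * x) → Val₂ k x
Val₂-halve {k} {x} (val₂ u u-odd eq) = val₂ u u-odd (ℤP.*-cancelˡ-≡ (+ 2) x _ (begin
  + 2 * x                      ≡⟨ eq ⟩
  + (2 ℕ.^ suc k) * u          ≡⟨ cong (_* u) (pow₂-suc k) ⟩
  + 2 * + (2 ℕ.^ k) * u        ≡⟨ ℤP.*-assoc (+ 2) (+ (2 ℕ.^ k)) u ⟩
  + 2 * (+ (2 ℕ.^ k) * u)      ∎))
  where open ≡-Reasoning

Val₂-* : Val₂ a x → Val₂ b y → Val₂ (a ℕ.+ b) (x * y)
Val₂-* {a} {b = b} (val₂ u u-odd refl) (val₂ v v-odd refl) =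
  val₂ (u * v) (odd-* u-odd v-odd)
    (trans (lemma (+ (2 ℕ.^ a)) (+ (2 ℕ.^ b)) u v) (cong (_* (u * v)) (sym (pow₂-+ a b))))
  where
  lemma : ∀ p q u v → p * u * (q * v) ≡ p * q * (u * v)
  lemma = solve-∀

Val₂-neg : Val₂ k x → Val₂ k (- x)
Val₂-neg {k} (val₂ u u-odd refl) = val₂ (- u) (odd-neg u-odd) (ℤP.neg-distribʳ-* (+ (2 ℕ.^ k)) u)

Val₂-+ : Val₂ k x → + (2 ℕ.^ suc k) ∣ y → Val₂ k (x + y)
Val₂-+ {k} (val₂ u u-odd refl) (divides r refl) =
  val₂ (u + r * + 2) (odd-+-even u-odd (divides r refl))
    (trans (cong (λ p → + (2 ℕ.^ k) * u + r * p) (pow₂-suc k)) (lemma (+ (2 ℕ.^ k)) u r))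
  where
  lemma : ∀ p u r → p * u + r * (+ 2 * p) ≡ p * (u + r * + 2)
  lemma = solve-∀

Val₂-≢0 : Val₂ k x → x ≢ + 0
Val₂-≢0 {k} (val₂ u u-odd refl) 2ᵏu≡0 with ℤP.i*j≡0⇒i≡0∨j≡0 (+ (2 ℕ.^ k)) 2ᵏu≡0
... | inj₁ 2ᵏ≡0 = ℕ.≢-nonZero⁻¹ (2 ℕ.^ k) {{ℕP.m^n≢0 2 k}} (ℤP.+-injective 2ᵏ≡0)
... | inj₂ refl = odd⇒¬even u-odd (divides (+ 0) refl)

Val₂-unique : Val₂ a x → Val₂ b x → a ≡ b
Val₂-unique {zero}  {b = zero}  _ _ = refl
Val₂-unique {zero}  {b = suc b} v w = ⊥-elim (odd⇒¬even (Val₂0⇒odd v) (Val₂-suc⇒even w))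
Val₂-unique {suc a} {b = zero}  v w = ⊥-elim (odd⇒¬even (Val₂0⇒odd w) (Val₂-suc⇒even v))
Val₂-unique {suc a} {b = suc b} v w with Val₂-suc⇒even v
... | divides y refl = cong suc (Val₂-unique (Val₂-halve (subst (Val₂ (suc a)) (ℤP.*-comm y (+ 2)) v))
                                             (Val₂-halve (subst (Val₂ (suc b)) (ℤP.*-comm y (+ 2)) w)))

Val₂⇒ν₂≡ : Val₂ k x → ν₂≡ x k
Val₂⇒ν₂≡ {k} {x} v@(val₂ u u-odd eq) =
  Val₂-≢0 v , ∣⇒∣ᵤ (Val₂⇒∣ v) , λ 2ᵏ⁺¹∣x → ¬2ᵏ⁺¹∣x (∣ᵤ⇒∣ 2ᵏ⁺¹∣x)
  where
  ¬2ᵏ⁺¹∣x : ¬ (+ (2 ℕ.^ suc k) ∣ x)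
  ¬2ᵏ⁺¹∣x (divides r eq′) = odd⇒¬even u-odd
    (divides r (ℤP.*-cancelˡ-≡ (+ (2 ℕ.^ k)) u (r * + 2) {{ℕP.m^n≢0 2 k}} (begin
    + (2 ℕ.^ k) * u          ≡⟨ sym eq ⟩
    x                        ≡⟨ eq′ ⟩
    r * + (2 ℕ.^ suc k)      ≡⟨ cong (r *_) (pow₂-suc k) ⟩
    r * (+ 2 * + (2 ℕ.^ k))  ≡⟨ lemma r (+ (2 ℕ.^ k)) ⟩
    + (2 ℕ.^ k) * (r * + 2)  ∎)))
    where
    open ≡-Reasoning
    lemma : ∀ r p → r * (+ 2 * p) ≡ p * (r * + 2)
    lemma = solve-∀

data Parity : ℕ → Set where
  even : ∀ j → Parity (j ℕ.+ j)
  odd  : ∀ j → Parity (suc (j ℕ.+ j))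

parity-view : ∀ m → Parity m
parity-view zero = even 0
parity-view (suc m) with parity-view m
... | even j = odd j
... | odd j  = subst Parity (cong suc (ℕP.+-suc j j)) (even (suc j))

-- Dyadic e m says ν₂(m + 1) = e.
data Dyadic : ℕ → ℕ → Set where
  odd   : ∀ j → Dyadic 0 (j ℕ.+ j)
  twice : Dyadic e m → Dyadic (suc e) (suc (m ℕ.+ m))

dyadic : ∀ m → ∃[ e ] Dyadic e m
dyadic = <-rec _ step
  where
  step : ∀ m → (∀ {j} → j ℕ.< m → ∃[ e ] Dyadic e j) → ∃[ e ] Dyadic e m
  step m rec with parity-view m
  ... | even j = 0 , odd j
  ... | odd j with rec (ℕ.s≤s (ℕP.m≤m+n j j))
  ...   | e , d = suc e , twice d

pos-double : ∀ j → + (j ℕ.+ j) ≡ + 2 * + j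
pos-double j = trans (cong (λ n → + (j ℕ.+ n)) (sym (ℕP.+-identityʳ j))) (ℤP.pos-* 2 j)

Dyadic⇒Val₂ : Dyadic e m → Val₂ e (+ suc m)
Dyadic⇒Val₂ (odd j) = odd⇒Val₂0 (+ j , cong (λ z → + 1 + z) (pos-double j))
Dyadic⇒Val₂ (twice {m = m} d) = subst (Val₂ _) (sym 2m+2≡2[m+1]) (Val₂-double (Dyadic⇒Val₂ d))
  where
  2m+2≡2[m+1] : + suc (suc (m ℕ.+ m)) ≡ + 2 * + suc m
  2m+2≡2[m+1] = trans (cong (λ n → + suc n) (sym (ℕP.+-suc m m))) (pos-double (suc m))

Val₂-exists : ∀ {x} → x ≢ + 0 → ∃[ k ] Val₂ k x
Val₂-exists {+ zero}   x≢0 = ⊥-elim (x≢0 refl)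
Val₂-exists {+ suc m}  _   with dyadic m
... | e , d = e , Dyadic⇒Val₂ d
Val₂-exists { -[1+ m ]} _  with dyadic m
... | e , d = e , Val₂-neg (Dyadic⇒Val₂ d)

popcountF-zero : ∀ f → popcountF f 0 ≡ 0
popcountF-zero zero    = refl
popcountF-zero (suc f) = popcountF-zero f

popcountF-fuel : ∀ {f g} m → m ℕ.≤ f → m ℕ.≤ g → popcountF f m ≡ popcountF g m
popcountF-fuel {f} {g} zero    _ _ = trans (popcountF-zero f) (sym (popcountF-zero g))
popcountF-fuel {suc f} {suc g} (suc m) m<f m<g =
  cong (suc m ℕ÷.% 2 ℕ.+_) (popcountF-fuel (suc m ℕ÷./ 2) (half< m<f) (half< m<g))
  where
  half< : ∀ {h} → suc m ℕ.≤ suc h → suc m ℕ÷./ 2 ℕ.≤ h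
  half< m≤h = ℕP.≤-pred (ℕP.≤-trans (ℕ÷.m/n<m (suc m) 2 (ℕ.s≤s (ℕ.s≤s ℕ.z≤n))) m≤h)

ζ₂-suc-unfold : ∀ m → ζ₂ (suc m) ≡ suc m ℕ÷.% 2 ℕ.+ ζ₂ (suc m ℕ÷./ 2)
ζ₂-suc-unfold m = cong (suc m ℕ÷.% 2 ℕ.+_) (popcountF-fuel (suc m ℕ÷./ 2) half≤m ℕP.≤-refl)
  where
  half≤m : suc m ℕ÷./ 2 ℕ.≤ m
  half≤m = ℕP.≤-pred (ℕ÷.m/n<m (suc m) 2 (ℕ.s≤s (ℕ.s≤s ℕ.z≤n)))

double≡*2 : ∀ j → j ℕ.+ j ≡ j ℕ.* 2
double≡*2 = ℕRing.solve-∀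

ζ₂-double : ∀ j → ζ₂ (j ℕ.+ j) ≡ ζ₂ j
ζ₂-double zero    = refl
ζ₂-double (suc j) = begin
  ζ₂ (suc j ℕ.+ suc j)                                          ≡⟨ ζ₂-suc-unfold (j ℕ.+ suc j) ⟩
  (suc j ℕ.+ suc j) ℕ÷.% 2 ℕ.+ ζ₂ ((suc j ℕ.+ suc j) ℕ÷./ 2)
    ≡⟨ cong₂ (λ r q → r ℕ.+ ζ₂ q) rem quot ⟩
  ζ₂ (suc j)                                                    ∎
  where
  open ≡-Reasoning
  rem : (suc j ℕ.+ suc j) ℕ÷.% 2 ≡ 0
  rem = trans (cong (ℕ÷._% 2) (double≡*2 (suc j))) (ℕ÷.m*n%n≡0 (suc j) 2)
  quot : (suc j ℕ.+ suc j) ℕ÷./ 2 ≡ suc j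
  quot = trans (cong (ℕ÷._/ 2) (double≡*2 (suc j))) (ℕ÷.m*n/n≡m (suc j) 2)

ζ₂-double+1 : ∀ j → ζ₂ (suc (j ℕ.+ j)) ≡ suc (ζ₂ j)
ζ₂-double+1 j = begin
  ζ₂ (suc (j ℕ.+ j))                                          ≡⟨ ζ₂-suc-unfold (j ℕ.+ j) ⟩
  suc (j ℕ.+ j) ℕ÷.% 2 ℕ.+ ζ₂ (suc (j ℕ.+ j) ℕ÷./ 2)
    ≡⟨ cong₂ (λ r q → r ℕ.+ ζ₂ q) rem quot ⟩
  suc (ζ₂ j)                                                  ∎
  where
  open ≡-Reasoning
  1+j*2 : suc (j ℕ.+ j) ≡ 1 ℕ.+ j ℕ.* 2
  1+j*2 = cong suc (double≡*2 j)
  rem : suc (j ℕ.+ j) ℕ÷.% 2 ≡ 1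
  rem = trans (cong (ℕ÷._% 2) 1+j*2) (ℕ÷.[m+kn]%n≡m%n 1 j 2)
  no-carry : 1 ℕ÷.% 2 ℕ.+ (j ℕ.* 2) ℕ÷.% 2 ℕ.< 2
  no-carry = subst (λ r → 1 ℕ.+ r ℕ.< 2) (sym (ℕ÷.m*n%n≡0 j 2)) ℕP.≤-refl
  quot : suc (j ℕ.+ j) ℕ÷./ 2 ≡ j
  quot = trans (cong (ℕ÷._/ 2) 1+j*2) (trans (ℕ÷.+-distrib-/ 1 (j ℕ.* 2) no-carry) (ℕ÷.m*n/n≡m j 2))

-- Legendre's formula ν₂(m!) = m − ζ₂(m), one factorial step at a time
ζ₂-suc : Dyadic e m → ζ₂ (suc m) ℕ.+ e ≡ suc (ζ₂ m)
ζ₂-suc (odd j) = begin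
  ζ₂ (suc (j ℕ.+ j)) ℕ.+ 0  ≡⟨ ℕP.+-identityʳ _ ⟩
  ζ₂ (suc (j ℕ.+ j))        ≡⟨ ζ₂-double+1 j ⟩
  suc (ζ₂ j)                ≡⟨ cong suc (ζ₂-double j) ⟨
  suc (ζ₂ (j ℕ.+ j))        ∎
  where open ≡-Reasoning
ζ₂-suc (twice {e} {m} d) = begin
  ζ₂ (suc (suc (m ℕ.+ m))) ℕ.+ suc e  ≡⟨ cong (λ n → ζ₂ (suc n) ℕ.+ suc e) (ℕP.+-suc m m) ⟨
  ζ₂ (suc m ℕ.+ suc m) ℕ.+ suc e      ≡⟨ cong (ℕ._+ suc e) (ζ₂-double (suc m)) ⟩
  ζ₂ (suc m) ℕ.+ suc e                ≡⟨ ℕP.+-suc (ζ₂ (suc m)) e ⟩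
  suc (ζ₂ (suc m) ℕ.+ e)              ≡⟨ cong suc (ζ₂-suc d) ⟩
  suc (suc (ζ₂ m))                    ≡⟨ cong suc (ζ₂-double+1 m) ⟨
  suc (ζ₂ (suc (m ℕ.+ m)))            ∎
  where open ≡-Reasoning

Val₂-cofactor : ∀ {a b x y} → Val₂ b x → Val₂ a (y * x) → ∃[ c ] Val₂ c y × c ℕ.+ b ≡ a
Val₂-cofactor {x = x} vx vyx =
  let c , vy = Val₂-exists (λ y≡0 → Val₂-≢0 vyx (trans (cong (_* x) y≡0) (ℤP.*-zeroˡ x)))
  in c , vy , Val₂-unique (Val₂-* vy vx) vyx

dyadic-consecutive : ∀ n →
  ∃[ e ] ((Dyadic 0 n × Dyadic (suc e) (suc n)) ⊎ (Dyadic (suc e) n × Dyadic 0 (suc n)))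
dyadic-consecutive n with parity-view n
... | even j = let e , d = dyadic j in e , inj₁ (odd j , twice d)
... | odd j  = let e , d = dyadic j
               in e , inj₂ (twice d , subst (Dyadic 0) (cong suc (ℕP.+-suc j j)) (odd (suc j)))

lucExp : ℕ → ℕ → ℕ
lucExp σ zero    = 0
lucExp σ (suc e) = σ ℕ.+ e

module Lucas (s t : ℤ) where

  L : ℕ → ℤ
  L = luc s t

  luc-+ : ∀ m n → L (suc (m ℕ.+ n)) ≡ L (suc m) * L (suc n) + t * L m * L n
  luc-+ m zero = begin
    L (suc (m ℕ.+ 0))                 ≡⟨ cong (λ k → L (suc k)) (ℕP.+-identityʳ m) ⟩
    L (suc m)                         ≡⟨ lemma (L (suc m)) (L m) t ⟩
    L (suc m) * + 1 + t * L m * + 0   ∎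
    where
    open ≡-Reasoning
    lemma : ∀ A B t → A ≡ A * + 1 + t * B * + 0
    lemma = solve-∀
  luc-+ m (suc zero) = begin
    L (suc (m ℕ.+ 1))                                ≡⟨ cong (λ k → L (suc k)) (ℕP.+-comm m 1) ⟩
    s * L (suc m) + t * L m                          ≡⟨ lemma (L (suc m)) (L m) s t ⟩
    L (suc m) * (s * + 1 + t * + 0) + t * L m * + 1  ∎
    where
    open ≡-Reasoning
    lemma : ∀ A B s t → s * A + t * B ≡ A * (s * + 1 + t * + 0) + t * B * + 1
    lemma = solve-∀
  luc-+ m (suc (suc n)) = begin
    L (suc (m ℕ.+ suc (suc n)))
      ≡⟨ cong (λ k → L (suc k)) (trans (ℕP.+-suc m (suc n)) (cong suc (ℕP.+-suc m n))) ⟩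
    s * L (suc (suc (m ℕ.+ n))) + t * L (suc (m ℕ.+ n))
      ≡⟨ cong (λ k → s * L (suc k) + t * L (suc (m ℕ.+ n))) (ℕP.+-suc m n) ⟨
    s * L (suc (m ℕ.+ suc n)) + t * L (suc (m ℕ.+ n))
      ≡⟨ cong₂ (λ u v → s * u + t * v) (luc-+ m (suc n)) (luc-+ m n) ⟩
    s * (L (suc m) * L (suc (suc n)) + t * L m * L (suc n)) + t * (L (suc m) * L (suc n) + t * L m * L n)
      ≡⟨ lemma (L (suc m)) (L m) (L (suc (suc n))) (L (suc n)) (L n) s t ⟩
    L (suc m) * L (suc (suc (suc n))) + t * L m * L (suc (suc n))  ∎
    where
    open ≡-Reasoning
    lemma : ∀ A B X Y Z s t → s * (A * X + t * B * Y) + t * (A * Y + t * B * Z)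
                          ≡ A * (s * X + t * Y) + t * B * (s * Y + t * Z)
    lemma = solve-∀

  -- 2{m+2} − s{m+1} is the companion Lucas number V_{m+1} = {m+2} + t{m}
  luc-double : ∀ m → L (suc (suc (m ℕ.+ m))) ≡ L (suc m) * (+ 2 * L (suc (suc m)) - s * L (suc m))
  luc-double m = begin
    L (suc (suc (m ℕ.+ m)))                        ≡⟨ luc-+ (suc m) m ⟩
    L (suc (suc m)) * L (suc m) + t * L (suc m) * L m ≡⟨ lemma (L (suc m)) (L m) s t ⟩
    L (suc m) * (+ 2 * L (suc (suc m)) - s * L (suc m)) ∎
    where
    open ≡-Reasoning
    lemma : ∀ A B s t → (s * A + t * B) * A + t * A * B ≡ A * (+ 2 * (s * A + t * B) - s * A)
    lemma = solve-∀

  s∣luc-even : ∀ k → s ∣ L (k ℕ.+ k)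
  s∣luc-even zero    = divides (+ 0) (sym (ℤP.*-zeroˡ s))
  s∣luc-even (suc k) = subst (λ n → s ∣ L n) (cong suc (sym (ℕP.+-suc k k)))
    (∣m∣n⇒∣m+n (∣m⇒∣m*n (L (suc (k ℕ.+ k))) ∣-refl) (∣n⇒∣m*n t (s∣luc-even k)))

  odd-luc-suc : IsOdd s → + 2 ∣ t → ∀ m → IsOdd (L (suc m))
  odd-luc-suc s-odd t-even zero    = + 0 , refl
  odd-luc-suc s-odd t-even (suc m) =
    odd-+-even (odd-* s-odd (odd-luc-suc s-odd t-even m)) (∣m⇒∣m*n (L m) t-even)

  odd-lfact : IsOdd s → + 2 ∣ t → ∀ n → IsOdd (lfact s t n)
  odd-lfact s-odd t-even zero    = + 0 , refl
  odd-lfact s-odd t-even (suc n) = odd-* (odd-lfact s-odd t-even n) (odd-luc-suc s-odd t-even n)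

  odd-luc-odd : + 2 ∣ s → IsOdd t → ∀ k → IsOdd (L (suc (k ℕ.+ k)))
  odd-luc-odd s-even t-odd zero    = + 0 , refl
  odd-luc-odd s-even t-odd (suc k) = subst (λ n → IsOdd (L (suc n))) (cong suc (sym (ℕP.+-suc k k)))
    (subst IsOdd (ℤP.+-comm (t * L (suc (k ℕ.+ k))) (s * L (suc (suc (k ℕ.+ k)))))
      (odd-+-even (odd-* t-odd (odd-luc-odd s-even t-odd k)) (∣m⇒∣m*n (L (suc (suc (k ℕ.+ k)))) s-even)))

  module Valuation {a : ℕ} (s-val : Val₂ (suc a) s) (t-odd : IsOdd t) where

    s-even : + 2 ∣ s
    s-even = Val₂-suc⇒even s-val

    val₂-companion-even : ∀ j → Val₂ (suc a) (+ 2 * L (suc (suc (j ℕ.+ j))) - s * L (suc (j ℕ.+ j)))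
    val₂-companion-even j = subst (Val₂ (suc a)) (ℤP.+-comm (- (s * L (suc (j ℕ.+ j)))) _)
      (Val₂-+ (Val₂-neg s·L) 2ᵃ⁺²∣2·L)
      where
      s·L : Val₂ (suc a) (s * L (suc (j ℕ.+ j)))
      s·L = subst (λ k → Val₂ k (s * L (suc (j ℕ.+ j)))) (ℕP.+-identityʳ (suc a))
        (Val₂-* s-val (odd⇒Val₂0 (odd-luc-odd s-even t-odd j)))
      s∣L : s ∣ L (suc (suc (j ℕ.+ j)))
      s∣L = subst (λ n → s ∣ L n) (cong suc (ℕP.+-suc j j)) (s∣luc-even (suc j))
      2ᵃ⁺²∣2·L : + (2 ℕ.^ suc (suc a)) ∣ + 2 * L (suc (suc (j ℕ.+ j)))
      2ᵃ⁺²∣2·L = subst (_∣ _) (sym (pow₂-suc (suc a)))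
        (*-pres-∣ (∣-refl {+ 2}) (∣-trans (Val₂⇒∣ s-val) s∣L))

    val₂-companion-odd : ∀ m →
      Val₂ 1 (+ 2 * L (suc (suc (suc (m ℕ.+ m)))) - s * L (suc (suc (m ℕ.+ m))))
    val₂-companion-odd m = Val₂-+ (Val₂-double (odd⇒Val₂0 L-odd)) (∣m⇒∣-m (*-pres-∣ s-even L-even))
      where
      L-odd : IsOdd (L (suc (suc (suc (m ℕ.+ m)))))
      L-odd = subst (λ n → IsOdd (L (suc n))) (cong suc (ℕP.+-suc m m)) (odd-luc-odd s-even t-odd (suc m))
      L-even : + 2 ∣ L (suc (suc (m ℕ.+ m)))
      L-even = subst (λ n → + 2 ∣ L n) (cong suc (ℕP.+-suc m m)) (∣-trans s-even (s∣luc-even (suc m)))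

    val₂-luc : ∀ {e m} → Dyadic e m → Val₂ (lucExp (suc a) e) (L (suc m))
    val₂-luc (odd j) = odd⇒Val₂0 (odd-luc-odd s-even t-odd j)
    val₂-luc (twice (odd j)) =
      subst₂ Val₂ (sym (ℕP.+-identityʳ (suc a))) (sym (luc-double (j ℕ.+ j)))
        (Val₂-* (val₂-luc (odd j)) (val₂-companion-even j))
    val₂-luc (twice (twice {e} {m} d)) =
      subst₂ Val₂ (trans (ℕP.+-assoc (suc a) e 1) (cong (suc a ℕ.+_) (ℕP.+-comm e 1)))
                  (sym (luc-double (suc (m ℕ.+ m))))
        (Val₂-* (val₂-luc (twice d)) (val₂-companion-odd m))

balance-step : ∀ {A B a e₁ e₂ g₁ g₂ z z′} →
  A ℕ.+ 1 ≡ B ℕ.+ z → z′ ℕ.+ e₂ ≡ suc z → g₁ ℕ.+ g₂ ≡ a ℕ.+ (e₁ ℕ.+ e₂) →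
  A ℕ.+ 0 ℕ.+ (suc a ℕ.+ e₁) ℕ.+ 1 ≡ B ℕ.+ g₁ ℕ.+ g₂ ℕ.+ z′
balance-step {A} {B} {a} {e₁} {e₂} {g₁} {g₂} {z} {z′} balanced ζ-step exponents =
  ℕP.+-cancelʳ-≡ e₂ _ _ (begin
    A ℕ.+ 0 ℕ.+ (suc a ℕ.+ e₁) ℕ.+ 1 ℕ.+ e₂  ≡⟨ ℕRing.solve (A ∷ a ∷ e₁ ∷ e₂ ∷ []) ⟩
    (A ℕ.+ 1) ℕ.+ (a ℕ.+ (e₁ ℕ.+ e₂)) ℕ.+ 1  ≡⟨ cong₂ (λ u v → u ℕ.+ v ℕ.+ 1) balanced (sym exponents) ⟩
    (B ℕ.+ z) ℕ.+ (g₁ ℕ.+ g₂) ℕ.+ 1          ≡⟨ ℕRing.solve (B ∷ z ∷ g₁ ∷ g₂ ∷ []) ⟩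
    B ℕ.+ g₁ ℕ.+ g₂ ℕ.+ suc z                 ≡⟨ cong (B ℕ.+ g₁ ℕ.+ g₂ ℕ.+_) ζ-step ⟨
    B ℕ.+ g₁ ℕ.+ g₂ ℕ.+ (z′ ℕ.+ e₂)          ≡⟨ ℕP.+-assoc (B ℕ.+ g₁ ℕ.+ g₂) z′ e₂ ⟨
    B ℕ.+ g₁ ℕ.+ g₂ ℕ.+ z′ ℕ.+ e₂            ∎)
  where open ≡-Reasoning

balance-exponent : ∀ {A B c z} → c ℕ.+ B ≡ A → A ℕ.+ 1 ≡ B ℕ.+ z → c ≡ z ∸ 1
balance-exponent {A} {B} {c} {z} c+B≡A balanced = begin
  c                 ≡⟨ ℕP.m+n∸n≡m c 1 ⟨
  c ℕ.+ 1 ∸ 1       ≡⟨ cong (_∸ 1) (ℕP.+-cancelˡ-≡ B _ _ B+c+1≡B+z) ⟩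
  z ∸ 1             ∎
  where
  open ≡-Reasoning
  B+c+1≡B+z : B ℕ.+ (c ℕ.+ 1) ≡ B ℕ.+ z
  B+c+1≡B+z = begin
    B ℕ.+ (c ℕ.+ 1)  ≡⟨ ℕRing.solve (B ∷ c ∷ []) ⟩
    c ℕ.+ B ℕ.+ 1    ≡⟨ cong (ℕ._+ 1) c+B≡A ⟩
    A ℕ.+ 1          ≡⟨ balanced ⟩
    B ℕ.+ z          ∎

module CatalanValuation {s t : ℤ} {a : ℕ} (s-val : Val₂ (suc a) s) (t-odd : IsOdd t) where
  open Lucas s t
  open Valuation s-val t-odd

  record Balance (n : ℕ) : Set where
    field
      {num den} : ℕ
      val₂-num  : Val₂ num (lfact s t (n ℕ.+ n))
      val₂-den  : Val₂ den (L (suc n) * (lfact s t n * lfact s t n))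
      balanced  : num ℕ.+ 1 ≡ den ℕ.+ ζ₂ (suc n)

  extend : ∀ {n e₁ e₂} → Dyadic e₁ n → Dyadic e₂ (suc n) →
           lucExp (suc a) e₁ ℕ.+ lucExp (suc a) e₂ ≡ a ℕ.+ (e₁ ℕ.+ e₂) →
           Balance n → Balance (suc n)
  extend {n} {e₁} {e₂} d₁ d₂ exponents b = record
    { val₂-num = subst (Val₂ _) (sym num-step)
        (Val₂-* (Val₂-* val₂-num (val₂-luc (odd n))) (val₂-luc (twice d₁)))
    ; val₂-den = subst (Val₂ _) (den-step (L (suc n)) (L (suc (suc n))) (lfact s t n))
        (Val₂-* (Val₂-* val₂-den (val₂-luc d₁)) (val₂-luc d₂))
    ; balanced = balance-step {B = den} {a} {e₁} {e₂} {lucExp (suc a) e₁} {lucExp (suc a) e₂} {ζ₂ (suc n)}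
                   balanced (ζ₂-suc d₂) exponents
    }
    where
    open Balance b
    num-step : lfact s t (suc n ℕ.+ suc n)
               ≡ lfact s t (n ℕ.+ n) * L (suc (n ℕ.+ n)) * L (suc (suc (n ℕ.+ n)))
    num-step = cong (λ k → lfact s t (suc k)) (ℕP.+-suc n n)
    den-step : ∀ L₁ L₂ f → L₁ * (f * f) * L₁ * L₂ ≡ L₂ * (f * L₁ * (f * L₁))
    den-step = solve-∀

  balance : ∀ n → Balance n
  balance zero = record
    { val₂-num = odd⇒Val₂0 (+ 0 , refl) ; val₂-den = odd⇒Val₂0 (+ 0 , refl) ; balanced = refl }
  balance (suc n) with dyadic-consecutive n
  ... | e , inj₁ (d₁ , d₂) = extend d₁ d₂ (sym (ℕP.+-suc a e)) (balance n)
  ... | e , inj₂ (d₁ , d₂) = extend d₁ d₂ (exponents a e) (balance n)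
    where
    exponents : ∀ a e → suc a ℕ.+ e ℕ.+ 0 ≡ a ℕ.+ (suc e ℕ.+ 0)
    exponents = ℕRing.solve-∀

  val₂-catalan-s≢0 : ∀ n P → IsCatalanPoly n P → Val₂ (ζ₂ (suc n) ∸ 1) (eval P s t)
  val₂-catalan-s≢0 n P cat =
    let c , val₂-P , c+den≡num = Val₂-cofactor val₂-den (subst (Val₂ num) (sym P·den≡num) val₂-num)
    in subst (λ k → Val₂ k (eval P s t)) (balance-exponent c+den≡num balanced) val₂-P
    where
    open Balance (balance n)
    P·den≡num : eval P s t * (L (suc n) * (lfact s t n * lfact s t n)) ≡ lfact s t (n ℕ.+ n)
    P·den≡num = trans (cat s t) (cong (λ k → lfact s t (n ℕ.+ k)) (ℕP.+-identityʳ n))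

eval-∣-sub : ∀ {d a a′} P b → d ∣ a - a′ → d ∣ eval P a b - eval P a′ b
eval-∣-sub {d} (con c) b _ = divides (+ 0) (trans (ℤP.+-inverseʳ c) (sym (ℤP.*-zeroˡ d)))
eval-∣-sub varS b d∣a-a′ = d∣a-a′
eval-∣-sub {d} varT b _ = divides (+ 0) (trans (ℤP.+-inverseʳ b) (sym (ℤP.*-zeroˡ d)))
eval-∣-sub {a = a} {a′} (p ⊕ q) b d∣a-a′ =
  subst (_ ∣_) (lemma (eval p a b) (eval q a b) (eval p a′ b) (eval q a′ b))
    (∣m∣n⇒∣m+n (eval-∣-sub p b d∣a-a′) (eval-∣-sub q b d∣a-a′))
  where
  lemma : ∀ x y x′ y′ → (x - x′) + (y - y′) ≡ (x + y) - (x′ + y′)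
  lemma = solve-∀
eval-∣-sub {a = a} {a′} (p ⊗ q) b d∣a-a′ =
  subst (_ ∣_) (lemma (eval p a b) (eval q a b) (eval p a′ b) (eval q a′ b))
    (∣m∣n⇒∣m+n (∣n⇒∣m*n (eval p a b) (eval-∣-sub q b d∣a-a′))
                (∣m⇒∣m*n (eval q a′ b) (eval-∣-sub p b d∣a-a′)))
  where
  lemma : ∀ x y x′ y′ → x * (y - y′) + (x - x′) * y′ ≡ x * y - x′ * y′
  lemma = solve-∀

Val₂-pow₂ : ∀ k → Val₂ k (+ (2 ℕ.^ k))
Val₂-pow₂ k = val₂ (+ 1) (+ 0 , refl) (sym (ℤP.*-identityʳ (+ (2 ℕ.^ k))))

val₂-catalan : ∀ {s t} → + 2 ∣ s → IsOdd t → ∀ n P → IsCatalanPoly n P →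
               Val₂ (ζ₂ (suc n) ∸ 1) (eval P s t)
val₂-catalan {s} s-even t-odd n P cat with s ℤ.≟ + 0
... | no s≢0 with Val₂-exists s≢0
...   | zero  , s-val = ⊥-elim (odd⇒¬even (Val₂0⇒odd s-val) s-even)
...   | suc _ , s-val = CatalanValuation.val₂-catalan-s≢0 s-val t-odd n P cat
val₂-catalan {t = t} s-even t-odd n P cat | yes refl =
  subst (Val₂ κ) (x+[y-x]≡y (eval P 2ᵏ⁺¹ t) (eval P (+ 0) t))
    (Val₂-+ (CatalanValuation.val₂-catalan-s≢0 (Val₂-pow₂ (suc κ)) t-odd n P cat)
            (eval-∣-sub P t 2ᵏ⁺¹∣0-2ᵏ⁺¹))
  where
  κ : ℕ
  κ = ζ₂ (suc n) ∸ 1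
  2ᵏ⁺¹ : ℤ
  2ᵏ⁺¹ = + (2 ℕ.^ suc κ)
  2ᵏ⁺¹∣0-2ᵏ⁺¹ : 2ᵏ⁺¹ ∣ + 0 - 2ᵏ⁺¹
  2ᵏ⁺¹∣0-2ᵏ⁺¹ = subst (2ᵏ⁺¹ ∣_) (sym (ℤP.+-identityˡ (- 2ᵏ⁺¹))) (∣m⇒∣-m ∣-refl)
  x+[y-x]≡y : ∀ x y → x + (y - x) ≡ y
  x+[y-x]≡y = solve-∀

odd-catalan : ∀ {s t} → IsOdd s → + 2 ∣ t → ∀ n P → IsCatalanPoly n P → IsOdd (eval P s t)
odd-catalan {s} {t} s-odd t-even n P cat with odd⊎even (eval P s t)
... | inj₁ P-odd  = P-odd
... | inj₂ P-even = ⊥-elim (odd⇒¬even (Lucas.odd-lfact s t s-odd t-even (2 ℕ.* n))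
                                       (subst (+ 2 ∣_) (cat s t) (∣m⇒∣m*n _ P-even)))

theorem6p4 : (s t : ℤ) → Odd (s + t) → (n : ℕ) → (P : Poly) → IsCatalanPoly n P →
    (Odd t → ν₂≡ (eval P s t) (ζ₂ (suc n) ∸ 1)) × (Even t → ν₂≡ (eval P s t) 0)
theorem6p4 s t s+t-odd n P cat = odd-t , even-t
  where
  s+t-odd′ : IsOdd (s + t)
  s+t-odd′ = Odd⇒IsOdd {s + t} s+t-odd
  m+n-n≡m : ∀ m n → m + n - n ≡ m
  m+n-n≡m = solve-∀
  odd-t : Odd t → ν₂≡ (eval P s t) (ζ₂ (suc n) ∸ 1)
  odd-t t-odd = Val₂⇒ν₂≡ (val₂-catalan s-even t-odd′ n P cat)
    where
    t-odd′ : IsOdd t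
    t-odd′ = Odd⇒IsOdd {t} t-odd
    s-even : + 2 ∣ s
    s-even = subst (+ 2 ∣_) (m+n-n≡m s t) (odd-odd⇒even-sub s+t-odd′ t-odd′)
  even-t : Even t → ν₂≡ (eval P s t) 0
  even-t t-even = Val₂⇒ν₂≡ (odd⇒Val₂0 (odd-catalan s-odd (∣ᵤ⇒∣ t-even) n P cat))
    where
    s-odd : IsOdd s
    s-odd = subst IsOdd (m+n-n≡m s t) (odd-+-even s+t-odd′ (∣m⇒∣-m (∣ᵤ⇒∣ t-even)))
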